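{- Let $k$ be even and let $G$ be a non-odd-bipartite $k$-uniform hypergraph. Then $G$ contains an odd-bipartite sub-hypergraph with at least $\varepsilon(G)/2$ edges.
   Context: A $k$-uniform hypergraph $G=(V(G),E(G))$ has every edge a $k$-subset of $V(G)$; $\varepsilon(G)=|E(G)|$. A sub-hypergraph is given by a subset of the vertices together with a subset of the edges contained in it. A $k$-uniform hypergraph is odd-bipartite if there is a bipartition $\{V_1,V_2\}$ of its vertex set such that every edge meets $V_1$ in an odd number of vertices; otherwise non-odd-bipartite. -}

module Defs where

open import Data.Nat using (ℕ)
open import Data.Nat.Divisibility using (_∣_)
open import Data.Fin.Subset using (Subset; _⊆_; _∩_; ∣_∣)
open import Data.List using (List)
open import Data.List.Relation.Unary.All using (All)
open import Data.List.Relation.Unary.Unique.Propositional using (Unique)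
import Data.List.Relation.Binary.Sublist.Propositional as SL
open import Data.Product using (Σ; ∃; _×_)
open import Relation.Binary.PropositionalEquality using (_≡_)
open import Relation.Nullary using (¬_)

-- A hypergraph whose vertex set is a subset of Fin n (the ambient universe).
-- Edges form a finite set (a duplicate-free list) of subsets of the vertex set.
record Hypergraph (n : ℕ) : Set where
  field
    verts   : Subset n
    edges   : List (Subset n)
    unique  : Unique edges
    inVerts : All (_⊆ verts) edges
open Hypergraph public

ε : ∀ {n} → Hypergraph n → ℕ
ε G = Data.List.length (edges G)

Uniform : ∀ {n} → ℕ → Hypergraph n → Set
Uniform k G = All (λ e → ∣ e ∣ ≡ k) (edges G)

Odd : ℕ → Set
Odd m = ¬ (2 ∣ m)

-- odd-bipartite: there is a bipartition {V₁ , verts G ∖ V₁} of the vertex set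
-- such that every edge meets V₁ in an odd number of vertices
OddBipartite : ∀ {n} → Hypergraph n → Set
OddBipartite {n} G =
  Σ (Subset n) λ V₁ → (V₁ ⊆ verts G) × All (λ e → Odd ∣ e ∩ V₁ ∣) (edges G)

SubHypergraph : ∀ {n} → Hypergraph n → Hypergraph n → Set
SubHypergraph H G = (verts H ⊆ verts G) × (edges H SL.⊆ edges G)

module Submission where

-- Induction on the number of vertices: delete vertex 0 and pick, by induction, a set V meeting at
-- least half of the edges avoiding 0 oddly. Putting 0 into V or not flips the meeting parity of
-- every edge through 0 at once, so one of the two choices also meets at least half of those
-- oddly.

open import Defs
open import Data.Nat using (ℕ; _≤_; _*_)
open import Data.Nat.Divisibility using (_∣_)
open import Data.Product using (Σ; _×_)
open import Relation.Nullary using (¬_)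

open import Data.Bool using (Bool; true; false; not; _xor_)
open import Data.Bool.Properties using (not-involutive) renaming (_≟_ to _≟ᵇ_)
open import Data.Fin.Subset using (Subset; _⊆_; _∩_; ∣_∣)
open import Data.Fin.Subset.Properties
  using (⊆-refl; ⊆-antisym; ∩-assoc; ∩-comm; p∩q⊆p; p∩q⊆q; x∈p∩q⁺)
open import Data.List using (List; []; _∷_; length; filter)
open import Data.List.Relation.Unary.All as All using (All; []; _∷_)
open import Data.List.Relation.Unary.All.Properties using (all-filter) renaming (filter⁺ to All-filter⁺)
open import Data.List.Relation.Unary.Unique.Propositional.Properties
  using () renaming (filter⁺ to Unique-filter⁺)
open import Data.List.Relation.Binary.Sublist.Propositional.Properties using (filter-⊆)
open import Data.Nat using (zero; suc; _+_; _<_; z≤n; s≤s)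
open import Data.Nat.Divisibility using (divides)
open import Data.Nat.Properties
  using (+-suc; +-comm; +-identityʳ; *-distribˡ-+; +-mono-≤; +-monoʳ-≤; _≤?_; ≰⇒≥; <-≤-trans
        ; module ≤-Reasoning)
open import Data.Product using (∃-syntax; _,_)
open import Data.Vec using ([]; _∷_)
open import Relation.Nullary using (does; yes; no)
open import Relation.Binary.PropositionalEquality
  using (_≡_; refl; sym; trans; cong; subst; module ≡-Reasoning)

oddᵇ : ℕ → Bool
oddᵇ zero    = false
oddᵇ (suc m) = not (oddᵇ m)

oddᵇ-even : ∀ q → oddᵇ (q * 2) ≡ false
oddᵇ-even zero = refl
oddᵇ-even (suc q) rewrite not-involutive (oddᵇ (q * 2)) = oddᵇ-even q

oddᵇ⇒Odd : ∀ m → oddᵇ m ≡ true → Odd m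
oddᵇ⇒Odd m odd (divides q refl) with () ← trans (sym odd) (oddᵇ-even q)

sum≤2*larger : ∀ {a b l} → b ≤ a → a + b ≡ l → l ≤ 2 * a
sum≤2*larger {a} {b} b≤a refl = subst (a + b ≤_) (cong (a +_) (sym (+-identityʳ a))) (+-monoʳ-≤ a b≤a)

p⊆q⇒p∩q≡p : ∀ {n} {p q : Subset n} → p ⊆ q → p ∩ q ≡ p
p⊆q⇒p∩q≡p {p = p} {q} p⊆q = ⊆-antisym (p∩q⊆p p q) (λ x∈p → x∈p∩q⁺ (x∈p , p⊆q x∈p))

∩-restrict : ∀ {n} (V W : Subset n) {e : Subset n} → e ⊆ W → e ∩ (V ∩ W) ≡ e ∩ V
∩-restrict V W {e} e⊆W = begin
  e ∩ (V ∩ W)  ≡⟨ cong (e ∩_) (∩-comm V W) ⟩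
  e ∩ (W ∩ V)  ≡⟨ sym (∩-assoc e W V) ⟩
  (e ∩ W) ∩ V  ≡⟨ cong (_∩ V) (p⊆q⇒p∩q≡p e⊆W) ⟩
  e ∩ V        ∎
  where open ≡-Reasoning

module _ {n : ℕ} where

  meetParity : Subset n → Subset n → Bool
  meetParity V e = oddᵇ ∣ e ∩ V ∣

  withMeetParity : Bool → Subset n → List (Subset n) → List (Subset n)
  withMeetParity p V = filter (λ e → meetParity V e ≟ᵇ p)

  length-withMeetParity : ∀ V L →
    length (withMeetParity true V L) + length (withMeetParity false V L) ≡ length L
  length-withMeetParity V [] = refl
  length-withMeetParity V (e ∷ L) with meetParity V e
  ... | true  = cong suc (length-withMeetParity V L)
  ... | false = trans (+-suc _ _) (cong suc (length-withMeetParity V L))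

  majorityMeetParity : ∀ V L → ∃[ p ] length L ≤ 2 * length (withMeetParity p V L)
  majorityMeetParity V L with length (withMeetParity false V L) ≤? length (withMeetParity true V L)
  ... | yes f≤t = true , sum≤2*larger f≤t (length-withMeetParity V L)
  ... | no f≰t  = false , sum≤2*larger (≰⇒≥ f≰t)
                            (trans (+-comm (length (withMeetParity false V L)) _) (length-withMeetParity V L))

outside₀ : ∀ {n} → List (Subset (suc n)) → List (Subset n)
outside₀ []                = []
outside₀ ((false ∷ e) ∷ L) = e ∷ outside₀ L
outside₀ ((true ∷ e) ∷ L)  = outside₀ L

inside₀ : ∀ {n} → List (Subset (suc n)) → List (Subset n)
inside₀ []                = []
inside₀ ((false ∷ e) ∷ L) = inside₀ L
inside₀ ((true ∷ e) ∷ L)  = e ∷ inside₀ L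

length-outside₀+inside₀ : ∀ {n} (L : List (Subset (suc n))) →
  length (outside₀ L) + length (inside₀ L) ≡ length L
length-outside₀+inside₀ []                = refl
length-outside₀+inside₀ ((false ∷ e) ∷ L) = cong suc (length-outside₀+inside₀ L)
length-outside₀+inside₀ ((true ∷ e) ∷ L)  = trans (+-suc _ _) (cong suc (length-outside₀+inside₀ L))

outside₀-nonempty : ∀ {n} (L : List (Subset (suc n))) →
  All (λ e → 0 < ∣ e ∣) L → All (λ e → 0 < ∣ e ∣) (outside₀ L)
outside₀-nonempty []                _          = []
outside₀-nonempty ((false ∷ e) ∷ L) (ne ∷ nes) = ne ∷ outside₀-nonempty L nes
outside₀-nonempty ((true ∷ e) ∷ L)  (_ ∷ nes)  = outside₀-nonempty L nes

-- Deleting vertex 0 shifts the meeting parity of an edge through 0 by whether 0 ∈ V.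
length-withMeetParity-∷ : ∀ {n} p b (V : Subset n) L →
  length (withMeetParity p (b ∷ V) L) ≡
  length (withMeetParity p V (outside₀ L)) + length (withMeetParity (b xor p) V (inside₀ L))
length-withMeetParity-∷ p b V [] = refl
length-withMeetParity-∷ p b V ((false ∷ e) ∷ L) with does (meetParity V e ≟ᵇ p)
... | true  = cong suc (length-withMeetParity-∷ p b V L)
... | false = length-withMeetParity-∷ p b V L
length-withMeetParity-∷ p false V ((true ∷ e) ∷ L) with does (meetParity V e ≟ᵇ p)
... | true  = trans (cong suc (length-withMeetParity-∷ p false V L)) (sym (+-suc _ _))
... | false = length-withMeetParity-∷ p false V L
length-withMeetParity-∷ p true V ((true ∷ e) ∷ L) with meetParity V e | p
... | true  | true  = length-withMeetParity-∷ true true V L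
... | true  | false = trans (cong suc (length-withMeetParity-∷ false true V L)) (sym (+-suc _ _))
... | false | true  = trans (cong suc (length-withMeetParity-∷ true true V L)) (sym (+-suc _ _))
... | false | false = length-withMeetParity-∷ false true V L

oddMeeting-half-step : ∀ {n} b (V : Subset n) L →
  length (outside₀ L) ≤ 2 * length (withMeetParity true V (outside₀ L)) →
  length (inside₀ L) ≤ 2 * length (withMeetParity (b xor true) V (inside₀ L)) →
  length L ≤ 2 * length (withMeetParity true (b ∷ V) L)
oddMeeting-half-step b V L outside-half inside-half = begin
  length L                                    ≡⟨ sym (length-outside₀+inside₀ L) ⟩
  length (outside₀ L) + length (inside₀ L)    ≤⟨ +-mono-≤ outside-half inside-half ⟩
  2 * m₀ + 2 * m₁                             ≡⟨ sym (*-distribˡ-+ 2 m₀ m₁) ⟩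
  2 * (m₀ + m₁)                               ≡⟨ cong (2 *_) (sym (length-withMeetParity-∷ true b V L)) ⟩
  2 * length (withMeetParity true (b ∷ V) L)  ∎
  where
  open ≤-Reasoning
  m₀ = length (withMeetParity true V (outside₀ L))
  m₁ = length (withMeetParity (b xor true) V (inside₀ L))

oddMeeting-half : ∀ {n} (L : List (Subset n)) → All (λ e → 0 < ∣ e ∣) L →
  ∃[ V ] length L ≤ 2 * length (withMeetParity true V L)
oddMeeting-half {zero} [] _ = [] , z≤n
oddMeeting-half {zero} ([] ∷ _) (() ∷ _)
oddMeeting-half {suc n} L nonempty with oddMeeting-half (outside₀ L) (outside₀-nonempty L nonempty)
... | V , outside-half with majorityMeetParity V (inside₀ L)
...   | true  , inside-half = false ∷ V , oddMeeting-half-step false V L outside-half inside-half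
...   | false , inside-half = true ∷ V , oddMeeting-half-step true V L outside-half inside-half

uniform⇒nonempty : ∀ {n k} (G : Hypergraph n) → 0 < k → Uniform k G →
  All (λ e → 0 < ∣ e ∣) (edges G)
uniform⇒nonempty G 0<k = All.map (λ ∣e∣≡k → subst (0 <_) (sym ∣e∣≡k) 0<k)

oddMeetingPart : ∀ {n} → Hypergraph n → Subset n → Hypergraph n
oddMeetingPart G V = record
  { verts   = verts G
  ; edges   = withMeetParity true V (edges G)
  ; unique  = Unique-filter⁺ _ (unique G)
  ; inVerts = All-filter⁺ _ (inVerts G)
  }

oddMeetingPart-sub : ∀ {n} (G : Hypergraph n) V → SubHypergraph (oddMeetingPart G V) G
oddMeetingPart-sub G V = ⊆-refl , filter-⊆ _ (edges G)

oddMeetingPart-oddBipartite : ∀ {n} (G : Hypergraph n) V → OddBipartite (oddMeetingPart G V)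
oddMeetingPart-oddBipartite G V =
  V ∩ verts G , p∩q⊆q V (verts G) ,
  All.zipWith oddCut (all-filter _ (edges G) , inVerts (oddMeetingPart G V))
  where
  oddCut : ∀ {e} → meetParity V e ≡ true × e ⊆ verts G → Odd ∣ e ∩ (V ∩ verts G) ∣
  oddCut {e} (odd , e⊆G) rewrite ∩-restrict V (verts G) e⊆G = oddᵇ⇒Odd ∣ e ∩ V ∣ odd

lemma5p1 : ∀ {n k : ℕ} → 2 ∣ k → 2 ≤ k → (G : Hypergraph n) → Uniform k G →
    ¬ OddBipartite G →
    Σ (Hypergraph n) λ H → SubHypergraph H G × OddBipartite H × (ε G ≤ 2 * ε H)
lemma5p1 _ 2≤k G uniform _
  with oddMeeting-half (edges G) (uniform⇒nonempty G (<-≤-trans (s≤s z≤n) 2≤k) uniform)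
... | V , half = oddMeetingPart G V , oddMeetingPart-sub G V , oddMeetingPart-oddBipartite G V , half
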